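{- Let $k\ge 9$ be an integer and let $r,s\in\mathbb{Z}_{2k}$ be such that $T_4(k,r,s)$ is a connected, simple, vertex-transitive graph. Then $r\neq s$ and $r\neq -s$.
   Context: $T_4(k,r,s)$ is the graph with vertex set $\{u_i,v_i,w_i: i\in\mathbb{Z}_{2k}\}$ and edges $u_iu_{i+k}$, $u_iv_i$, $u_iw_i$, $w_iw_{i+r}$, $v_iv_{i+s}$ ($i\in\mathbb{Z}_{2k}$). -}

module Defs where

open import Data.Nat using (ℕ; zero; suc; _+_; _∸_)
open import Data.Nat.DivMod using (_%_; m%n<n)
open import Data.Fin using (Fin; toℕ; fromℕ<)
open import Data.Product using (Σ; _×_; _,_)
open import Data.Sum using (_⊎_)
open import Relation.Binary.PropositionalEquality using (_≡_)
open import Relation.Nullary using (¬_)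
open import Function.Bundles using (_↔_; Inverse)

-- The cyclic group ℤ_n, represented by Fin n

_⊕_ : ∀ {n} → Fin n → Fin n → Fin n
_⊕_ {suc n} a b = fromℕ< (m%n<n (toℕ a + toℕ b) (suc n))

⊖_ : ∀ {n} → Fin n → Fin n
⊖_ {suc n} a = fromℕ< (m%n<n (suc n ∸ toℕ a) (suc n))

_⊕ℕ_ : ∀ {n} → Fin n → ℕ → Fin n
_⊕ℕ_ {suc n} a m = fromℕ< (m%n<n (toℕ a + m) (suc n))

record Graph : Set₁ where
  field
    V   : Set
    Adj : V → V → Set

open Graph public

-- simple: no loops (edges form a set, so no multiple edges arise)
Simple : Graph → Set
Simple G = ∀ x → ¬ Adj G x x

data Walk (G : Graph) : V G → V G → Set where
  here : ∀ x → Walk G x x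
  step : ∀ {x y z} → Adj G x y → Walk G y z → Walk G x z

Connected : Graph → Set
Connected G = ∀ x y → Walk G x y

IsAutomorphism : (G : Graph) → (V G ↔ V G) → Set
IsAutomorphism G σ =
  ∀ x y → (Adj G x y → Adj G (Inverse.to σ x) (Inverse.to σ y))
        × (Adj G (Inverse.to σ x) (Inverse.to σ y) → Adj G x y)

VertexTransitive : Graph → Set
VertexTransitive G =
  ∀ x y → Σ (V G ↔ V G) λ σ → IsAutomorphism G σ × (Inverse.to σ x ≡ y)

data Kind : Set where
  u v w : Kind

T4Vertex : ℕ → Set
T4Vertex k = Kind × Fin (k + k)

-- the listed edges, oriented as written
data T4Edge (k : ℕ) (r s : Fin (k + k)) : T4Vertex k → T4Vertex k → Set where
  uu : ∀ i → T4Edge k r s (u , i) (u , i ⊕ℕ k)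
  uv : ∀ i → T4Edge k r s (u , i) (v , i)
  uw : ∀ i → T4Edge k r s (u , i) (w , i)
  ww : ∀ i → T4Edge k r s (w , i) (w , i ⊕ r)
  vv : ∀ i → T4Edge k r s (v , i) (v , i ⊕ s)

T4 : (k : ℕ) → Fin (k + k) → Fin (k + k) → Graph
T4 k r s = record
  { V   = T4Vertex k
  ; Adj = λ x y → T4Edge k r s x y ⊎ T4Edge k r s y x
  }

module Submission where

-- Suppose r = ±s.  Then the w-cycle runs parallel to the v-cycle, and every edge
-- at v₀ lies on a hexagon: a closed walk of length six through the edge that
-- does not turn back (the 6-cycles u_a v_a v_{a+s} u_{a+s} w_{a+s} w_a).
-- Hexagons are invariant under automorphisms, so by vertex-transitivity the
-- antipodal edge u₀u_k lies on a hexagon as well.  Such a hexagon must leave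
-- u_k by a spoke and come back to u₀ after one or three steps ±T along the
-- v-cycle (T = s) or the w-cycle (T = r), so k + eT ≡ 0 (mod 2k) for some
-- e ∈ {±1, ±3}; with r = ±s this gives k ∣ 3s.  As k ≥ 4, d = gcd(k, s) ≥ 2,
-- and d divides k, s and r.  But then every vertex reachable from u₀ has index
-- divisible by d, so u₁ is unreachable, contradicting connectedness.

open import Defs
open import Data.Nat as ℕ using (ℕ; zero; suc; _+_; _≤_; _<_; _≥_; s≤s; z≤n)
open import Data.Nat.Properties as ℕ using ()
open import Data.Nat.Divisibility as ℕ using ()
open import Data.Nat.DivMod using (_%_; _/_; m%n<n; m≡m%n+[m/n]*n; m<n⇒m%n≡m)
open import Data.Nat.GCD using (gcd; gcd[m,n]∣m; gcd[m,n]∣n; gcd[m,n]≡0⇒m≡0)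
open import Data.Nat.Coprimality using (coprime-divisor; gcd≡1⇒coprime)
open import Data.Fin as Fin using (Fin; toℕ; fromℕ<)
open import Data.Fin.Properties using (toℕ-fromℕ<; toℕ-injective; toℕ<n)
open import Data.Integer as ℤ using (ℤ; +_; -_; 0ℤ; 1ℤ; -1ℤ)
open import Data.Integer.Properties as ℤ using (pos-+; pos-*; m-n≡m⊖n; ∣⊖∣-≤)
open import Data.Integer.Divisibility.Signed
  using (divides; ∣-refl; ∣-trans; ∣ᵤ⇒∣; ∣⇒∣ᵤ; ∣m∣n⇒∣m+n; ∣m⇒∣-m; ∣n⇒∣m*n; ∣m+n∣m⇒∣n)
  renaming (_∣_ to _∣ℤ_)
open import Data.Integer.Tactic.RingSolver using (solve-∀)
open import Data.Product using (Σ; _×_; _,_; proj₁; proj₂)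
open import Data.Sum using (_⊎_; inj₁; inj₂)
open import Data.Empty using (⊥; ⊥-elim)
open import Relation.Nullary using (¬_)
open import Relation.Binary.Bundles using (Setoid)
open import Relation.Binary.Structures using (IsEquivalence)
open import Relation.Binary.PropositionalEquality
  using (_≡_; _≢_; refl; sym; trans; cong; subst; subst₂; module ≡-Reasoning)
import Relation.Binary.Reasoning.Setoid as SetoidReasoning
open import Function.Bundles using (_↔_; Inverse)
open import Function.Base using (_$_; _∘_; id)

module Congruence (m : ℤ) where

  infix 4 _≋_
  record _≋_ (a b : ℤ) : Set where
    constructor congruent
    field m∣a-b : m ∣ℤ a ℤ.- b

  ≋-refl : ∀ {a} → a ≋ a
  ≋-refl {a} = congruent $ divides 0ℤ (a-a≡0*m a m)
    where
    a-a≡0*m : ∀ a m → a ℤ.- a ≡ 0ℤ ℤ.* m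
    a-a≡0*m = solve-∀

  ≋-sym : ∀ {a b} → a ≋ b → b ≋ a
  ≋-sym {a} {b} (congruent m∣a-b) = congruent $ subst (m ∣ℤ_) (negate a b) (∣m⇒∣-m m∣a-b)
    where
    negate : ∀ a b → - (a ℤ.- b) ≡ b ℤ.- a
    negate = solve-∀

  ≋-trans : ∀ {a b c} → a ≋ b → b ≋ c → a ≋ c
  ≋-trans {a} {b} {c} (congruent m∣a-b) (congruent m∣b-c) = congruent $ subst (m ∣ℤ_) (telescope a b c) (∣m∣n⇒∣m+n m∣a-b m∣b-c)
    where
    telescope : ∀ a b c → (a ℤ.- b) ℤ.+ (b ℤ.- c) ≡ a ℤ.- c
    telescope = solve-∀

  ≋-isEquivalence : IsEquivalence _≋_
  ≋-isEquivalence = record { refl = ≋-refl ; sym = ≋-sym ; trans = ≋-trans }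

  ≋-setoid : Setoid _ _
  ≋-setoid = record { isEquivalence = ≋-isEquivalence }

  ≋-reflexive : ∀ {a b} → a ≡ b → a ≋ b
  ≋-reflexive refl = ≋-refl

  ≋-+ : ∀ {a b c d} → a ≋ b → c ≋ d → a ℤ.+ c ≋ b ℤ.+ d
  ≋-+ {a} {b} {c} {d} (congruent m∣a-b) (congruent m∣c-d) = congruent $ subst (m ∣ℤ_) (regroup a b c d) (∣m∣n⇒∣m+n m∣a-b m∣c-d)
    where
    regroup : ∀ a b c d → (a ℤ.- b) ℤ.+ (c ℤ.- d) ≡ (a ℤ.+ c) ℤ.- (b ℤ.+ d)
    regroup = solve-∀

  ≋-* : ∀ c {a b} → a ≋ b → c ℤ.* a ≋ c ℤ.* b
  ≋-* c {a} {b} (congruent m∣a-b) = congruent $ subst (m ∣ℤ_) (distrib c a b) (∣n⇒∣m*n c m∣a-b)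
    where
    distrib : ∀ c a b → c ℤ.* (a ℤ.- b) ≡ c ℤ.* a ℤ.- c ℤ.* b
    distrib = solve-∀

  m≋0 : m ≋ 0ℤ
  m≋0 = congruent $ divides 1ℤ (m-0≡1*m m)
    where
    m-0≡1*m : ∀ m → m ℤ.- 0ℤ ≡ 1ℤ ℤ.* m
    m-0≡1*m = solve-∀

  ≋-cancel : ∀ {a x} → a ≋ a ℤ.+ x → x ≋ 0ℤ
  ≋-cancel {a} {x} (congruent m∣a-[a+x]) = congruent $ subst (m ∣ℤ_) (negate a x) (∣m⇒∣-m m∣a-[a+x])
    where
    negate : ∀ a x → - (a ℤ.- (a ℤ.+ x)) ≡ x ℤ.- 0ℤ
    negate = solve-∀

module Residues (n : ℕ) where

  N : ℕ
  N = suc n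

  open Congruence (+ N) public

  ι : Fin N → ℤ
  ι a = + toℕ a

  %-≋ : ∀ x → + (x % N) ≋ + x
  %-≋ x = ≋-sym (congruent (divides (+ (x / N)) (begin
      + x ℤ.- + (x % N)                         ≡⟨ cong (λ y → + y ℤ.- + (x % N)) (m≡m%n+[m/n]*n x N) ⟩
      + (x % N ℕ.+ x / N ℕ.* N) ℤ.- + (x % N)   ≡⟨ cong (ℤ._- + (x % N)) (pos-+ (x % N) (x / N ℕ.* N)) ⟩
      + (x % N) ℤ.+ + (x / N ℕ.* N) ℤ.- + (x % N) ≡⟨ cong (λ y → + (x % N) ℤ.+ y ℤ.- + (x % N)) (pos-* (x / N) N) ⟩
      + (x % N) ℤ.+ + (x / N) ℤ.* + N ℤ.- + (x % N) ≡⟨ cancel-left (+ (x % N)) (+ (x / N) ℤ.* + N) ⟩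
      + (x / N) ℤ.* + N                          ∎)))
    where
    open ≡-Reasoning
    cancel-left : ∀ p q → p ℤ.+ q ℤ.- p ≡ q
    cancel-left = solve-∀

  ι-⊕ℕ : ∀ a m → ι (a ⊕ℕ m) ≋ ι a ℤ.+ + m
  ι-⊕ℕ a m = begin
    ι (a ⊕ℕ m)             ≡⟨ cong +_ (toℕ-fromℕ< (m%n<n (toℕ a ℕ.+ m) N)) ⟩
    + ((toℕ a ℕ.+ m) % N)  ≈⟨ %-≋ (toℕ a ℕ.+ m) ⟩
    + (toℕ a ℕ.+ m)        ≡⟨ pos-+ (toℕ a) m ⟩
    ι a ℤ.+ + m            ∎
    where open SetoidReasoning ≋-setoid

  ι-⊕ : ∀ a b → ι (a ⊕ b) ≋ ι a ℤ.+ ι b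
  ι-⊕ a b = ι-⊕ℕ a (toℕ b)

  ι-⊖ : ∀ a → ι (⊖ a) ≋ - ι a
  ι-⊖ a = begin
    ι (⊖ a)                  ≡⟨ cong +_ (toℕ-fromℕ< (m%n<n (N ℕ.∸ toℕ a) N)) ⟩
    + ((N ℕ.∸ toℕ a) % N)    ≈⟨ %-≋ (N ℕ.∸ toℕ a) ⟩
    + (N ℕ.∸ toℕ a)          ≡⟨ shift (+ (N ℕ.∸ toℕ a)) (ι a) ⟩
    + (N ℕ.∸ toℕ a) ℤ.+ ι a ℤ.+ - ι a  ≡⟨ cong (ℤ._+ - ι a) N-a+a≡N ⟩
    + N ℤ.+ - ι a            ≈⟨ ≋-+ m≋0 (≋-refl { - ι a}) ⟩
    0ℤ ℤ.+ - ι a             ≡⟨ ℤ.+-identityˡ (- ι a) ⟩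
    - ι a                    ∎
    where
    open SetoidReasoning ≋-setoid
    shift : ∀ x y → x ≡ x ℤ.+ y ℤ.+ - y
    shift = solve-∀
    N-a+a≡N : + (N ℕ.∸ toℕ a) ℤ.+ ι a ≡ + N
    N-a+a≡N = trans (sym (pos-+ (N ℕ.∸ toℕ a) (toℕ a))) (cong +_ (ℕ.m∸n+n≡m (ℕ.<⇒≤ (toℕ<n a))))

  private
    close-residues : ∀ {x y} → x ≤ y → y < N → + x ≋ + y → x ≡ y
    close-residues {x} {y} x≤y y<N (congruent N∣x-y) = ℕ.≤-antisym x≤y (ℕ.m∸n≡0⇒m≤n y-x≡0)
      where
      N∣y-x : N ℕ.∣ y ℕ.∸ x
      N∣y-x = subst (N ℕ.∣_) (trans (cong ℤ.∣_∣ (m-n≡m⊖n x y)) (∣⊖∣-≤ x≤y)) (∣⇒∣ᵤ N∣x-y)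
      y-x≡0 : y ℕ.∸ x ≡ 0
      y-x≡0 = trans (sym (m<n⇒m%n≡m (ℕ.≤-<-trans (ℕ.m∸n≤m y x) y<N))) (ℕ.n∣m⇒m%n≡0 (y ℕ.∸ x) N N∣y-x)

  ι-injective : ∀ {a b} → ι a ≋ ι b → a ≡ b
  ι-injective {a} {b} ιa≋ιb with ℕ.≤-total (toℕ a) (toℕ b)
  ... | inj₁ a≤b = toℕ-injective (close-residues a≤b (toℕ<n b) ιa≋ιb)
  ... | inj₂ b≤a = toℕ-injective (sym (close-residues b≤a (toℕ<n a) (≋-sym ιa≋ιb)))

  ∣-⊕ℕ : ∀ {d m} a → d ℕ.∣ N → d ℕ.∣ m → d ℕ.∣ toℕ a → d ℕ.∣ toℕ (a ⊕ℕ m)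
  ∣-⊕ℕ {d} {m} a d∣N d∣m d∣a = subst (d ℕ.∣_) (sym (toℕ-fromℕ< (m%n<n (toℕ a ℕ.+ m) N)))
    (ℕ.%-presˡ-∣ (ℕ.∣m∣n⇒∣m+n d∣a d∣m) d∣N)

  ∣-⊕ℕ⁻ : ∀ {d m} a → d ℕ.∣ N → d ℕ.∣ m → d ℕ.∣ toℕ (a ⊕ℕ m) → d ℕ.∣ toℕ a
  ∣-⊕ℕ⁻ {d} {m} a d∣N d∣m d∣a⊕m = ℕ.∣m+n∣m⇒∣n (subst (d ℕ.∣_) (ℕ.+-comm (toℕ a) m) d∣a+m) d∣m
    where
    d∣a+m : d ℕ.∣ toℕ a ℕ.+ m
    d∣a+m = ℕ.∣n∣m%n⇒∣m d∣N (subst (d ℕ.∣_) (toℕ-fromℕ< (m%n<n (toℕ a ℕ.+ m) N)) d∣a⊕m)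

  ∣-⊖ : ∀ {d} a → d ℕ.∣ N → d ℕ.∣ toℕ a → d ℕ.∣ toℕ (⊖ a)
  ∣-⊖ {d} a d∣N d∣a = subst (d ℕ.∣_) (sym (toℕ-fromℕ< (m%n<n (N ℕ.∸ toℕ a) N)))
    (ℕ.%-presˡ-∣ d∣N-a d∣N)
    where
    d∣N-a : d ℕ.∣ N ℕ.∸ toℕ a
    d∣N-a = ℕ.∣m+n∣m⇒∣n (subst (d ℕ.∣_) (sym (ℕ.m+[n∸m]≡n (ℕ.<⇒≤ (toℕ<n a)))) d∣N) d∣a

module _ {G : Graph} where

  walk-preserves : (P : V G → Set) → (∀ {x y} → Adj G x y → P x → P y) →
                   ∀ {x y} → Walk G x y → P x → P y
  walk-preserves P preserved (here _)      Px = Px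
  walk-preserves P preserved (step xy yz) Px = walk-preserves P preserved yz (preserved xy Px)

  record Hexagon (x y : V G) : Set where
    constructor hexagon
    field
      {p₁ p₂ p₃ p₄} : V G
      xy   : Adj G x y
      yp₁  : Adj G y p₁
      p₁p₂ : Adj G p₁ p₂
      p₂p₃ : Adj G p₂ p₃
      p₃p₄ : Adj G p₃ p₄
      p₄x  : Adj G p₄ x
      p₁≢x : p₁ ≢ x
      p₂≢y : p₂ ≢ y
      p₄≢y : p₄ ≢ y

  hexagon-reflect : (σ : V G ↔ V G) → IsAutomorphism G σ →
                    ∀ {x y} → Hexagon (Inverse.to σ x) (Inverse.to σ y) → Hexagon x y
  hexagon-reflect σ aut {x} {y} (hexagon xy yp₁ p₁p₂ p₂p₃ p₃p₄ p₄x p₁≢x p₂≢y p₄≢y) =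
    subst₂ Hexagon (strictlyInverseʳ x) (strictlyInverseʳ y)
      (hexagon (pull xy) (pull yp₁) (pull p₁p₂) (pull p₂p₃) (pull p₃p₄) (pull p₄x)
               (p₁≢x ∘ from-injective) (p₂≢y ∘ from-injective) (p₄≢y ∘ from-injective))
    where
    open Inverse σ
    pull : ∀ {a b} → Adj G a b → Adj G (from a) (from b)
    pull {a} {b} ab = proj₂ (aut (from a) (from b))
      (subst₂ (Adj G) (sym (strictlyInverseˡ a)) (sym (strictlyInverseˡ b)) ab)
    from-injective : ∀ {a b} → from a ≡ from b → a ≡ b
    from-injective {a} {b} e = trans (sym (strictlyInverseˡ a)) (trans (cong to e) (strictlyInverseˡ b))

gcd≥2 : ∀ {k} t → 4 ≤ k → k ℕ.∣ 3 ℕ.* t → 2 ≤ gcd k t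
gcd≥2 {k} t 4≤k k∣3t with gcd k t in eq
... | zero = ⊥-elim (ℕ.<⇒≢ (ℕ.≤-trans (s≤s z≤n) 4≤k) (sym (gcd[m,n]≡0⇒m≡0 eq)))
... | suc zero = ⊥-elim (ℕ.<⇒≱ 4≤k (ℕ.∣⇒≤ k∣3))
  where
  k∣3 : k ℕ.∣ 3
  k∣3 = coprime-divisor (gcd≡1⇒coprime eq) (subst (k ℕ.∣_) (ℕ.*-comm 3 t) k∣3t)
... | suc (suc _) = s≤s (s≤s z≤n)

-- The coefficients ±1 (one step along a cycle v_i v_{i+s} or w_i w_{i+r}) and
-- the odd coefficients ±1, ±3 that are sums of one or of three such steps.
data Sign : ℤ → Set where
  plus  : Sign 1ℤ
  minus : Sign -1ℤ

data SmallOdd : ℤ → Set where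
  one         : SmallOdd 1ℤ
  minus-one   : SmallOdd -1ℤ
  three       : SmallOdd (+ 3)
  minus-three : SmallOdd (- + 3)

sign-smallOdd : ∀ {e} → Sign e → SmallOdd e
sign-smallOdd plus  = one
sign-smallOdd minus = minus-one

sum-smallOdd : ∀ {a b c} → Sign a → Sign b → Sign c → SmallOdd (a ℤ.+ b ℤ.+ c)
sum-smallOdd plus  plus  plus  = three
sum-smallOdd plus  plus  minus = one
sum-smallOdd plus  minus plus  = one
sum-smallOdd plus  minus minus = minus-one
sum-smallOdd minus plus  plus  = one
sum-smallOdd minus plus  minus = minus-one
sum-smallOdd minus minus plus  = minus-one
sum-smallOdd minus minus minus = minus-three

smallOdd-neg : ∀ {e} → SmallOdd e → SmallOdd (- e)
smallOdd-neg one         = minus-one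
smallOdd-neg minus-one   = one
smallOdd-neg three       = minus-three
smallOdd-neg minus-three = three

cofactor : ∀ {e} → SmallOdd e → ℤ
cofactor one         = + 3
cofactor minus-one   = - + 3
cofactor three       = 1ℤ
cofactor minus-three = -1ℤ

cofactor-spec : ∀ {e} (o : SmallOdd e) → cofactor o ℤ.* e ≡ + 3
cofactor-spec one         = refl
cofactor-spec minus-one   = refl
cofactor-spec three       = refl
cofactor-spec minus-three = refl

-- The graph T₄(k, r, s) with k = suc k′; indices live in ℤ_N with N = k + k.
module T4Structure (k′ : ℕ) (r s : Fin (suc k′ ℕ.+ suc k′)) where

  k : ℕ
  k = suc k′

  open Residues (k′ ℕ.+ suc k′)

  G : Graph
  G = T4 k r s

  Vertex : Set
  Vertex = T4Vertex k

  infix 4 _~_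
  _~_ : Vertex → Vertex → Set
  _~_ = Adj G

  ~-sym : ∀ {x y} → x ~ y → y ~ x
  ~-sym (inj₁ e) = inj₂ e
  ~-sym (inj₂ e) = inj₁ e

  antipode-involutive : ∀ i → (i ⊕ℕ k) ⊕ℕ k ≡ i
  antipode-involutive i = ι-injective (begin
    ι ((i ⊕ℕ k) ⊕ℕ k)          ≈⟨ ι-⊕ℕ (i ⊕ℕ k) k ⟩
    ι (i ⊕ℕ k) ℤ.+ + k         ≈⟨ ≋-+ (ι-⊕ℕ i k) (≋-refl {+ k}) ⟩
    ι i ℤ.+ + k ℤ.+ + k        ≡⟨ ℤ.+-assoc (ι i) (+ k) (+ k) ⟩
    ι i ℤ.+ (+ k ℤ.+ + k)      ≡⟨ cong (λ z → ι i ℤ.+ z) (sym (pos-+ k k)) ⟩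
    ι i ℤ.+ + N                ≈⟨ ≋-+ (≋-refl {ι i}) m≋0 ⟩
    ι i ℤ.+ 0ℤ                 ≡⟨ ℤ.+-identityʳ (ι i) ⟩
    ι i                        ∎)
    where open SetoidReasoning ≋-setoid

  data UNeighbour (i : Fin N) : Vertex → Set where
    antipode : UNeighbour i (u , i ⊕ℕ k)
    spoke    : ∀ {c} → c ≢ u → UNeighbour i (c , i)

  u-neighbour : ∀ {p i} → p ~ (u , i) → UNeighbour i p
  u-neighbour (inj₁ (uu j)) = subst (λ j′ → UNeighbour (j ⊕ℕ k) (u , j′)) (antipode-involutive j) antipode
  u-neighbour (inj₂ (uu i)) = antipode
  u-neighbour (inj₂ (uv i)) = spoke λ ()
  u-neighbour (inj₂ (uw i)) = spoke λ ()

  data LineNeighbour (c : Kind) (T a : Fin N) : Vertex → Set where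
    spoke : LineNeighbour c T a (u , a)
    along : ∀ {b e} → Sign e → ι b ≋ ι a ℤ.+ e ℤ.* ι T → LineNeighbour c T a (c , b)

  private
    step-forward : ∀ a T → ι (a ⊕ T) ≋ ι a ℤ.+ 1ℤ ℤ.* ι T
    step-forward a T = ≋-trans (ι-⊕ a T) (≋-reflexive (cong (λ z → ι a ℤ.+ z) (sym (ℤ.*-identityˡ (ι T)))))

    step-backward : ∀ b T → ι b ≋ ι (b ⊕ T) ℤ.+ -1ℤ ℤ.* ι T
    step-backward b T = begin
      ι b                                   ≡⟨ undo (ι b) (ι T) ⟩
      ι b ℤ.+ ι T ℤ.+ -1ℤ ℤ.* ι T           ≈⟨ ≋-+ (ι-⊕ b T) (≋-refl { -1ℤ ℤ.* ι T}) ⟨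
      ι (b ⊕ T) ℤ.+ -1ℤ ℤ.* ι T             ∎
      where
      open SetoidReasoning ≋-setoid
      undo : ∀ x y → x ≡ x ℤ.+ y ℤ.+ -1ℤ ℤ.* y
      undo = solve-∀

  v-neighbour : ∀ {a p} → (v , a) ~ p → LineNeighbour v s a p
  v-neighbour (inj₁ (vv a)) = along plus (step-forward a s)
  v-neighbour (inj₂ (uv a)) = spoke
  v-neighbour (inj₂ (vv b)) = along minus (step-backward b s)

  w-neighbour : ∀ {a p} → (w , a) ~ p → LineNeighbour w r a p
  w-neighbour (inj₁ (ww a)) = along plus (step-forward a r)
  w-neighbour (inj₂ (uw a)) = spoke
  w-neighbour (inj₂ (ww b)) = along minus (step-backward b r)

  -- T closes the antipodal edge when k + e·T ≡ 0 (mod 2k) for some e ∈ {±1, ±3}: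
  -- one or three steps ±T along a cycle undo the shift by k.
  Closes : Fin N → Set
  Closes T = Σ ℤ λ e → SmallOdd e × (+ k ℤ.+ e ℤ.* ι T ≋ 0ℤ)

  returns : ∀ {i T e} → SmallOdd e → ι i ≋ ι (i ⊕ℕ k) ℤ.+ e ℤ.* ι T → Closes T
  returns {i} {T} {e} o back = e , o , ≋-cancel (begin
    ι i                                   ≈⟨ back ⟩
    ι (i ⊕ℕ k) ℤ.+ e ℤ.* ι T              ≈⟨ ≋-+ (ι-⊕ℕ i k) (≋-refl {e ℤ.* ι T}) ⟩
    ι i ℤ.+ + k ℤ.+ e ℤ.* ι T             ≡⟨ ℤ.+-assoc (ι i) (+ k) (e ℤ.* ι T) ⟩
    ι i ℤ.+ (+ k ℤ.+ e ℤ.* ι T)           ∎)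
    where open SetoidReasoning ≋-setoid

  -- Walking c_{i+k}, p₂, p₃, p₄, u_i inside the subgraph spanned by the cycle of
  -- kind c (step T) and its spokes, without returning to u_{i+k}, forces the
  -- walk to move one or three steps along the cycle, so T closes.
  closes-along-cycle : ∀ {c T i p₂ p₃ p₄} → c ≢ u →
    (∀ {a p} → (c , a) ~ p → LineNeighbour c T a p) →
    (c , i ⊕ℕ k) ~ p₂ → p₂ ~ p₃ → p₃ ~ p₄ → p₄ ~ (u , i) →
    p₂ ≢ (u , i ⊕ℕ k) → p₄ ≢ (u , i ⊕ℕ k) → Closes T
  closes-along-cycle {c} {T} {i} c≢u neighbour p₁p₂ p₂p₃ p₃p₄ p₄x p₂≢y p₄≢y
    with neighbour p₁p₂ | u-neighbour p₄x
  ... | spoke       | _              = ⊥-elim (p₂≢y refl)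
  ... | along _ _   | antipode       = ⊥-elim (p₄≢y refl)
  ... | along {e = e₂} σ₂ h₂ | spoke c′≢u with neighbour p₂p₃
  ...   | spoke with u-neighbour (~-sym p₃p₄)
  ...     | antipode = ⊥-elim (c′≢u refl)
  ...     | spoke _  = returns (sign-smallOdd σ₂) h₂
  closes-along-cycle {c} {T} {i} c≢u neighbour p₁p₂ p₂p₃ p₃p₄ p₄x p₂≢y p₄≢y
      | along {e = e₂} σ₂ h₂ | spoke c′≢u | along {e = e₃} σ₃ h₃ with neighbour p₃p₄
  ...   | spoke                 = ⊥-elim (c′≢u refl)
  ...   | along {e = e₄} σ₄ h₄  = returns (sum-smallOdd σ₂ σ₃ σ₄) (three-steps e₂ e₃ e₄ h₂ h₃ h₄)
    where
    three-steps : ∀ {j₁ j₂ j₃ j₄} e₂ e₃ e₄ →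
      ι j₂ ≋ ι j₁ ℤ.+ e₂ ℤ.* ι T → ι j₃ ≋ ι j₂ ℤ.+ e₃ ℤ.* ι T → ι j₄ ≋ ι j₃ ℤ.+ e₄ ℤ.* ι T →
      ι j₄ ≋ ι j₁ ℤ.+ (e₂ ℤ.+ e₃ ℤ.+ e₄) ℤ.* ι T
    three-steps {j₁} {j₂} {j₃} {j₄} e₂ e₃ e₄ h₂ h₃ h₄ = begin
      ι j₄                                                      ≈⟨ h₄ ⟩
      ι j₃ ℤ.+ e₄ ℤ.* ι T                                       ≈⟨ ≋-+ h₃ (≋-refl {e₄ ℤ.* ι T}) ⟩
      ι j₂ ℤ.+ e₃ ℤ.* ι T ℤ.+ e₄ ℤ.* ι T                        ≈⟨ ≋-+ (≋-+ h₂ (≋-refl {e₃ ℤ.* ι T})) (≋-refl {e₄ ℤ.* ι T}) ⟩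
      ι j₁ ℤ.+ e₂ ℤ.* ι T ℤ.+ e₃ ℤ.* ι T ℤ.+ e₄ ℤ.* ι T         ≡⟨ collect (ι j₁) e₂ e₃ e₄ (ι T) ⟩
      ι j₁ ℤ.+ (e₂ ℤ.+ e₃ ℤ.+ e₄) ℤ.* ι T                       ∎
      where
      open SetoidReasoning ≋-setoid
      collect : ∀ x a b c t → x ℤ.+ a ℤ.* t ℤ.+ b ℤ.* t ℤ.+ c ℤ.* t ≡ x ℤ.+ (a ℤ.+ b ℤ.+ c) ℤ.* t
      collect = solve-∀

  -- A hexagon through an antipodal edge u_i u_{i+k} must run along the v-cycle
  -- or the w-cycle, so s or r closes.
  closes-at-antipodal-edge : ∀ {i} → Hexagon {G} (u , i) (u , i ⊕ℕ k) → Closes s ⊎ Closes r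
  closes-at-antipodal-edge {i} (hexagon _ yp₁ p₁p₂ p₂p₃ p₃p₄ p₄x p₁≢x p₂≢y p₄≢y)
    with u-neighbour (~-sym yp₁)
  ... | antipode        = ⊥-elim (p₁≢x (cong (u ,_) (antipode-involutive i)))
  ... | spoke {c = u} u≢u = ⊥-elim (u≢u refl)
  ... | spoke {c = v} _ = inj₁ (closes-along-cycle (λ ()) v-neighbour p₁p₂ p₂p₃ p₃p₄ p₄x p₂≢y p₄≢y)
  ... | spoke {c = w} _ = inj₂ (closes-along-cycle (λ ()) w-neighbour p₁p₂ p₂p₃ p₃p₄ p₄x p₂≢y p₄≢y)

  w-step : r ≡ s ⊎ r ≡ ⊖ s → ∀ a → (w , a) ~ (w , a ⊕ s)
  w-step (inj₁ refl) a = inj₁ (ww a)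
  w-step (inj₂ refl) a = inj₂ (subst (λ b → T4Edge k (⊖ s) s (w , a ⊕ s) (w , b)) a+s-s≡a (ww (a ⊕ s)))
    where
    a+s-s≡a : (a ⊕ s) ⊕ (⊖ s) ≡ a
    a+s-s≡a = ι-injective (begin
      ι ((a ⊕ s) ⊕ (⊖ s))          ≈⟨ ι-⊕ (a ⊕ s) (⊖ s) ⟩
      ι (a ⊕ s) ℤ.+ ι (⊖ s)        ≈⟨ ≋-+ (ι-⊕ a s) (ι-⊖ s) ⟩
      ι a ℤ.+ ι s ℤ.+ - ι s        ≡⟨ cancel (ι a) (ι s) ⟩
      ι a                          ∎)
      where
      open SetoidReasoning ≋-setoid
      cancel : ∀ x y → x ℤ.+ y ℤ.+ - y ≡ x
      cancel = solve-∀

  -- When r = ±s, every edge at v_i lies on a hexagon: the walks around the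
  -- 6-cycles u_a v_a v_{a+s} u_{a+s} w_{a+s} w_a.
  hexagon-at-v : r ≡ s ⊎ r ≡ ⊖ s → ∀ {i y} → (v , i) ~ y → Hexagon {G} (v , i) y
  hexagon-at-v r≡±s xy@(inj₂ (uv i)) =
    hexagon xy (inj₁ (uw i)) (w-step r≡±s i) (inj₂ (uw (i ⊕ s))) (inj₁ (uv (i ⊕ s))) (inj₂ (vv i))
      (λ ()) (λ ()) (λ ())
  hexagon-at-v r≡±s xy@(inj₁ (vv i)) =
    hexagon xy (inj₂ (uv (i ⊕ s))) (inj₁ (uw (i ⊕ s))) (~-sym (w-step r≡±s i)) (inj₂ (uw i)) (inj₁ (uv i))
      (λ ()) (λ ()) (λ ())
  hexagon-at-v r≡±s xy@(inj₂ (vv j)) =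
    hexagon xy (inj₂ (uv j)) (inj₁ (uw j)) (w-step r≡±s j) (inj₂ (uw (j ⊕ s))) (inj₁ (uv (j ⊕ s)))
      (λ ()) (λ ()) (λ ())

  -- An automorphism moving u₀ to v₀ maps the antipodal edge u₀u_k to an edge
  -- at v₀; pulling back the hexagon there gives a hexagon through u₀u_k.
  antipodal-hexagon : r ≡ s ⊎ r ≡ ⊖ s → VertexTransitive G → Hexagon {G} (u , Fin.zero) (u , Fin.zero ⊕ℕ k)
  antipodal-hexagon r≡±s transitive with transitive (u , Fin.zero) (v , Fin.zero)
  ... | σ , automorphism , σx≡v₀ =
    hexagon-reflect σ automorphism
      (subst (λ z → Hexagon {G} z (to (u , Fin.zero ⊕ℕ k))) (sym σx≡v₀)
        (hexagon-at-v r≡±s (subst (_~ to (u , Fin.zero ⊕ℕ k)) σx≡v₀ σxσy)))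
    where
    open Inverse σ using (to)
    σxσy : to (u , Fin.zero) ~ to (u , Fin.zero ⊕ℕ k)
    σxσy = proj₁ (automorphism (u , Fin.zero) (u , Fin.zero ⊕ℕ k)) (inj₁ (uu Fin.zero))

  closes-⊖ : ∀ {T} → Closes (⊖ T) → Closes T
  closes-⊖ {T} (e , odd , closed) = - e , smallOdd-neg odd , (begin
    + k ℤ.+ - e ℤ.* ι T          ≡⟨ move-sign (+ k) e (ι T) ⟩
    + k ℤ.+ e ℤ.* - ι T          ≈⟨ ≋-+ (≋-refl {+ k}) (≋-* e (ι-⊖ T)) ⟨
    + k ℤ.+ e ℤ.* ι (⊖ T)        ≈⟨ closed ⟩
    0ℤ                           ∎)
    where
    open SetoidReasoning ≋-setoid
    move-sign : ∀ x e t → x ℤ.+ - e ℤ.* t ≡ x ℤ.+ e ℤ.* - t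
    move-sign = solve-∀

  s-closes : r ≡ s ⊎ r ≡ ⊖ s → Closes s ⊎ Closes r → Closes s
  s-closes _           (inj₁ s-closes) = s-closes
  s-closes (inj₁ refl) (inj₂ r-closes) = r-closes
  s-closes (inj₂ refl) (inj₂ r-closes) = closes-⊖ r-closes

  -- k + e·T ≡ 0 (mod 2k) gives k ∣ e·T, and multiplying by the cofactor of e, k ∣ 3T.
  closes⇒∣3T : ∀ {T} → Closes T → k ℕ.∣ 3 ℕ.* toℕ T
  closes⇒∣3T {T} (e , odd , congruent N∣k+eT) = ∣⇒∣ᵤ k∣3T
    where
    k∣N : + k ∣ℤ + N
    k∣N = ∣ᵤ⇒∣ (ℕ.∣m∣n⇒∣m+n (ℕ.∣-refl {k}) (ℕ.∣-refl {k}))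
    k∣eT : + k ∣ℤ e ℤ.* ι T
    k∣eT = ∣m+n∣m⇒∣n (∣-trans k∣N (subst (+ N ∣ℤ_) (ℤ.+-identityʳ _) N∣k+eT)) (∣-refl {+ k})
    cofactor·eT≡3T : cofactor odd ℤ.* (e ℤ.* ι T) ≡ + (3 ℕ.* toℕ T)
    cofactor·eT≡3T = begin
      cofactor odd ℤ.* (e ℤ.* ι T)   ≡⟨ ℤ.*-assoc (cofactor odd) e (ι T) ⟨
      cofactor odd ℤ.* e ℤ.* ι T     ≡⟨ cong (ℤ._* ι T) (cofactor-spec odd) ⟩
      + 3 ℤ.* ι T                    ≡⟨ pos-* 3 (toℕ T) ⟨
      + (3 ℕ.* toℕ T)                ∎
      where open ≡-Reasoning
    k∣3T : + k ∣ℤ + (3 ℕ.* toℕ T)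
    k∣3T = subst (+ k ∣ℤ_) cofactor·eT≡3T (∣n⇒∣m*n (cofactor odd) k∣eT)

  ∣r : ∀ {d} → r ≡ s ⊎ r ≡ ⊖ s → d ℕ.∣ k → d ℕ.∣ toℕ s → d ℕ.∣ toℕ r
  ∣r (inj₁ refl) d∣k d∣s = d∣s
  ∣r (inj₂ refl) d∣k d∣s = ∣-⊖ s (ℕ.∣m∣n⇒∣m+n d∣k d∣k) d∣s

  -- A common divisor d ≥ 2 of k, r and s divides the index of every vertex
  -- reachable from u₀ (each edge shifts the index by 0, k, r or s modulo 2k),
  -- but not the index 1 of u₁.
  disconnected : ∀ {d} → 2 ≤ d → d ℕ.∣ k → d ℕ.∣ toℕ r → d ℕ.∣ toℕ s → ¬ Connected G
  disconnected {d} 2≤d d∣k d∣r d∣s connected =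
    ℕ.<⇒≢ 2≤d (sym (ℕ.∣1⇒≡1 (subst (d ℕ.∣_) (toℕ-fromℕ< 1<N) d∣1)))
    where
    d∣N : d ℕ.∣ N
    d∣N = ℕ.∣m∣n⇒∣m+n d∣k d∣k
    MultipleOfD : Vertex → Set
    MultipleOfD (_ , i) = d ℕ.∣ toℕ i
    forward : ∀ {x y} → T4Edge k r s x y → MultipleOfD x → MultipleOfD y
    forward (uu i) = ∣-⊕ℕ i d∣N d∣k
    forward (uv i) = id
    forward (uw i) = id
    forward (ww i) = ∣-⊕ℕ i d∣N d∣r
    forward (vv i) = ∣-⊕ℕ i d∣N d∣s
    backward : ∀ {x y} → T4Edge k r s x y → MultipleOfD y → MultipleOfD x
    backward (uu i) = ∣-⊕ℕ⁻ i d∣N d∣k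
    backward (uv i) = id
    backward (uw i) = id
    backward (ww i) = ∣-⊕ℕ⁻ i d∣N d∣r
    backward (vv i) = ∣-⊕ℕ⁻ i d∣N d∣s
    preserved : ∀ {x y} → x ~ y → MultipleOfD x → MultipleOfD y
    preserved (inj₁ xy) = forward xy
    preserved (inj₂ yx) = backward yx
    1<N : 1 < N
    1<N = s≤s (ℕ.≤-trans (s≤s z≤n) (ℕ.m≤n+m (suc k′) k′))
    d∣1 : d ℕ.∣ toℕ (fromℕ< 1<N)
    d∣1 = walk-preserves MultipleOfD preserved (connected (u , Fin.zero) (u , fromℕ< 1<N)) (ℕ._∣0 d)

lemma7p3 : (k : ℕ) → k ≥ 9 → (r s : Fin (k + k)) →
    Connected (T4 k r s) → Simple (T4 k r s) → VertexTransitive (T4 k r s) →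
    (r ≢ s) × (r ≢ ⊖ s)
lemma7p3 (suc k′) 9≤k r s connected _ transitive =
  (λ r≡s → r≢±s (inj₁ r≡s)) , (λ r≡⊖s → r≢±s (inj₂ r≡⊖s))
  where
  open T4Structure k′ r s
  r≢±s : r ≡ s ⊎ r ≡ ⊖ s → ⊥
  r≢±s r≡±s = disconnected 2≤d d∣k (∣r r≡±s d∣k d∣s) d∣s connected
    where
    k∣3s : k ℕ.∣ 3 ℕ.* toℕ s
    k∣3s = closes⇒∣3T (s-closes r≡±s (closes-at-antipodal-edge (antipodal-hexagon r≡±s transitive)))
    d : ℕ
    d = gcd k (toℕ s)
    2≤d : 2 ≤ d
    2≤d = gcd≥2 (toℕ s) (ℕ.≤-trans (s≤s (s≤s (s≤s (s≤s z≤n)))) 9≤k) k∣3s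
    d∣k : d ℕ.∣ k
    d∣k = gcd[m,n]∣m k (toℕ s)
    d∣s : d ℕ.∣ toℕ s
    d∣s = gcd[m,n]∣n k (toℕ s)
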